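{- Let $k,n>1$ be integers. There exists an exact covering system consisting of exactly $k$ congruence classes, all of whose moduli are powers of $n$, if and only if $k\equiv 1 \pmod{n-1}$.
   Context: For $a,m\in\mathbb{Z}$ with $m\geq 2$, the congruence class $a \pmod m$ is the set of integers congruent to $a$ modulo $m$. A system of congruences is a finite collection of congruence classes $\{r_1 \pmod{m_1},\dots,r_k \pmod{m_k}\}$ (each $m_i\geq 2$; moduli may repeat). It is a covering system if every integer lies in at least one of the classes, and it is exact if the $k$ congruence classes are pairwise disjoint. -}

module Defs where

open import Data.Nat using (ℕ; _≤_; _^_)
open import Data.Integer using (ℤ; +_; _-_)
open import Data.Integer.Divisibility using () renaming (_∣_ to _∣ℤ_)
open import Data.Fin using (Fin)
open import Data.Product using (_×_; ∃; proj₁; proj₂)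
open import Relation.Binary.PropositionalEquality using (_≡_; _≢_)
open import Relation.Nullary using (¬_)

InClass : ℤ → ℕ → ℤ → Set
InClass r m x = (+ m) ∣ℤ (x - r)

record CongSystem (k : ℕ) : Set where
  field
    residue : Fin k → ℤ
    modulus : Fin k → ℕ
    modulus≥2 : ∀ i → 2 ≤ modulus i
open CongSystem public

Covering : ∀ {k} → CongSystem k → Set
Covering {k} S = ∀ (x : ℤ) → ∃ λ (i : Fin k) → InClass (residue S i) (modulus S i) x

Exact : ∀ {k} → CongSystem k → Set
Exact {k} S = ∀ (i j : Fin k) → i ≢ j → ∀ (x : ℤ) →
  ¬ (InClass (residue S i) (modulus S i) x × InClass (residue S j) (modulus S j) x)

IsPowerOf : ℕ → ℕ → Set
IsPowerOf n m = ∃ λ (e : ℕ) → m ≡ n ^ e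

AllModuliPowersOf : ∀ {k} → ℕ → CongSystem k → Set
AllModuliPowersOf {k} n S = ∀ (i : Fin k) → IsPowerOf n (modulus S i)

-- Necessity: put N = n ^ E with E ≥ every exponent. Each class r (mod n ^ e) contains exactly
-- n ^ (E ∸ e) of 0, 1, …, N − 1, and an exact covering puts each of these numbers in exactly
-- one class, so n ^ E = Σᵢ n ^ (E ∸ eᵢ). Every power of n is 1 modulo n − 1, hence
-- 1 ≡ k (mod n − 1).
-- Sufficiency: if {rᵢ (mod mᵢ)} is an exact covering, so is
-- {j (mod n) : 1 ≤ j < n} ∪ {n rᵢ (mod n mᵢ)}, which has n − 1 more classes. Starting from
-- the single class 0 (mod 1) this produces exact coverings of every size 1 + q (n − 1).
module Submission where

open import Defs
open import Data.Nat using (ℕ; _<_; _∸_)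
open import Data.Nat.Divisibility using (_∣_)
open import Data.Product using (_×_; ∃)
open import Function.Bundles using (_⇔_)

open import Data.Nat using (zero; suc; _+_; _*_; _^_; _≤_; z≤n; s≤s; NonZero; >-nonZero)
open import Data.Nat.Properties
open import Data.Nat.Divisibility
  using (divides; _∣?_; _∣0; 1∣_; >⇒∤; ∣m+n∣m⇒∣n; m∣m*n; ∣-trans; *-monoʳ-∣; *-cancelˡ-∣)
open import Data.Integer as ℤ using (ℤ; +_; 0ℤ; 1ℤ)
import Data.Integer.Properties as ℤ
import Data.Integer.Divisibility as ℤᵤ
open import Data.Integer.Divisibility.Signed using (∣ᵤ⇒∣; ∣⇒∣ᵤ)
  renaming (_∣_ to _∣ℤ_; divides to dividesℤ)
import Data.Integer.Divisibility.Signed as ℤ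
open import Data.Integer.DivMod using (_%ℕ_; _/ℕ_; n%ℕd<d; a≡a%ℕn+[a/ℕn]*n)
open import Data.Integer.Tactic.RingSolver using (solve-∀)
import Data.Nat.Tactic.RingSolver as NS
open import Data.Fin using (Fin; zero; suc; toℕ; fromℕ<; punchIn)
open import Data.Fin.Properties using (punchInᵢ≢i; +↔⊎)
import Data.Fin.Properties as Fin
open import Algebra.Properties.Semiring.Sum +-*-semiring
  using (sum; sum-syntax; sum-cong-≗; sum-remove; sum-replicate-zero; ∑-comm; ∑-distrib-+; *-distribˡ-sum)
open import Data.Product using (_,_; proj₁; proj₂)
open import Data.Sum using (_⊎_; inj₁; inj₂)
open import Function.Base using (_∘_)
open import Function.Bundles using (mk⇔; Equivalence; _↔_; Inverse; Injection)
open import Function.Properties.Inverse using (↔⇒↣)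
open import Relation.Binary.PropositionalEquality
open import Relation.Nullary using (Dec; yes; no; ¬_; contradiction)

ExactPowerCovering : ℕ → ℕ → Set
ExactPowerCovering n k = ∃ λ (S : CongSystem k) → Covering S × Exact S × AllModuliPowersOf n S

𝟙 : {P : Set} → Dec P → ℕ
𝟙 (yes _) = 1
𝟙 (no _)  = 0

𝟙-yes : {P : Set} (P? : Dec P) → P → 𝟙 P? ≡ 1
𝟙-yes (yes _) _  = refl
𝟙-yes (no ¬p) p = contradiction p ¬p

𝟙-no : {P : Set} (P? : Dec P) → ¬ P → 𝟙 P? ≡ 0
𝟙-no (yes p) ¬p = contradiction p ¬p
𝟙-no (no _)  _  = refl

𝟙-cong : {P Q : Set} → P ⇔ Q → (P? : Dec P) (Q? : Dec Q) → 𝟙 P? ≡ 𝟙 Q?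
𝟙-cong P⇔Q (yes p) Q? = sym (𝟙-yes Q? (Equivalence.to P⇔Q p))
𝟙-cong P⇔Q (no ¬p) Q? = sym (𝟙-no Q? (¬p ∘ Equivalence.from P⇔Q))

∑-1 : ∀ k → ∑[ i < k ] 1 ≡ k
∑-1 zero    = refl
∑-1 (suc k) = cong suc (∑-1 k)

∑-𝟙-unique : ∀ {k} {P : Fin k → Set} (P? : ∀ i → Dec (P i)) {i} →
             P i → (∀ j → j ≢ i → ¬ P j) → ∑[ j < k ] 𝟙 (P? j) ≡ 1
∑-𝟙-unique {suc k} P? {i} Pi others = begin
  ∑[ j < suc k ] 𝟙 (P? j)                     ≡⟨ sum-remove {i = i} (𝟙 ∘ P?) ⟩
  𝟙 (P? i) + ∑[ j < k ] 𝟙 (P? (punchIn i j)) ≡⟨ cong₂ _+_ (𝟙-yes (P? i) Pi) rest≡0 ⟩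
  1                                           ∎
  where
  open ≡-Reasoning
  rest≡0 : ∑[ j < k ] 𝟙 (P? (punchIn i j)) ≡ 0
  rest≡0 = trans (sum-cong-≗ λ j → 𝟙-no (P? _) (others _ (punchInᵢ≢i i j))) (sum-replicate-zero k)

term≤∑ : ∀ {k} (f : Fin k → ℕ) i → f i ≤ ∑[ j < k ] f j
term≤∑ {suc k} f i = subst (f i ≤_) (sym (sum-remove {i = i} f)) (m≤m+n (f i) _)

sumBelow : ℕ → (ℕ → ℕ) → ℕ
sumBelow N f = ∑[ x < N ] f (toℕ x)

sumBelow-cong : ∀ N {f g : ℕ → ℕ} → (∀ x → f x ≡ g x) → sumBelow N f ≡ sumBelow N g
sumBelow-cong N {f} {g} f≗g = sum-cong-≗ {N} {f ∘ toℕ} {g ∘ toℕ} (f≗g ∘ toℕ)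

sumBelow-+ : ∀ m N f → sumBelow (m + N) f ≡ sumBelow m f + sumBelow N (λ x → f (m + x))
sumBelow-+ zero    N f = refl
sumBelow-+ (suc m) N f =
  trans (cong (_+_ (f 0)) (sumBelow-+ m N (f ∘ suc))) (sym (+-assoc (f 0) _ _))

Periodic : ℕ → (ℕ → ℕ) → Set
Periodic m f = ∀ x → f (m + x) ≡ f x

sumBelow-translate : ∀ {m f} → Periodic m f → ∀ t → sumBelow m (λ y → f (t + y)) ≡ sumBelow m f
sumBelow-translate {m} {f} per t = +-cancelˡ-≡ (sumBelow t f) _ _ (begin
  sumBelow t f + sumBelow m (λ y → f (t + y)) ≡⟨ sumBelow-+ t m f ⟨
  sumBelow (t + m) f                          ≡⟨ cong (λ N → sumBelow N f) (+-comm t m) ⟩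
  sumBelow (m + t) f                          ≡⟨ sumBelow-+ m t f ⟩
  sumBelow m f + sumBelow t (λ y → f (m + y)) ≡⟨ cong (_+_ (sumBelow m f)) (sumBelow-cong t per) ⟩
  sumBelow m f + sumBelow t f                 ≡⟨ +-comm (sumBelow m f) _ ⟩
  sumBelow t f + sumBelow m f                 ∎)
  where open ≡-Reasoning

sumBelow-periodic : ∀ {m f} → Periodic m f → ∀ q → sumBelow (q * m) f ≡ q * sumBelow m f
sumBelow-periodic         per zero    = refl
sumBelow-periodic {m} {f} per (suc q) =
  trans (sumBelow-+ m (q * m) f)
        (cong (_+_ (sumBelow m f)) (trans (sumBelow-cong (q * m) per) (sumBelow-periodic per q)))

inClass? : ∀ r m x → Dec (InClass r m x)
inClass? r m x = m ∣? ℤ.∣ x ℤ.- r ∣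

χ : ℤ → ℕ → ℕ → ℕ
χ r m x = 𝟙 (inClass? r m (+ x))

∣ᵤ-shift : ∀ {m u v} c → u ≡ v ℤ.+ c ℤ.* + m → + m ℤᵤ.∣ u ⇔ + m ℤᵤ.∣ v
∣ᵤ-shift {m} {u} {v} c refl = mk⇔
  (λ m∣u → ∣⇒∣ᵤ {i = v} (ℤ.∣m+n∣n⇒∣m (∣ᵤ⇒∣ {i = u} m∣u) m∣c*m))
  (λ m∣v → ∣⇒∣ᵤ {i = u} (ℤ.∣m∣n⇒∣m+n (∣ᵤ⇒∣ {i = v} m∣v) m∣c*m))
  where
  m∣c*m : + m ∣ℤ c ℤ.* + m
  m∣c*m = ℤ.∣n⇒∣m*n c ℤ.∣-refl

χ-periodic : ∀ r m → Periodic m (χ r m)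
χ-periodic r m x = 𝟙-cong (∣ᵤ-shift {v = + x ℤ.- r} 1ℤ shift) _ _
  where
  identity : ∀ a b c → (a ℤ.+ b) ℤ.- c ≡ (b ℤ.- c) ℤ.+ 1ℤ ℤ.* a
  identity = solve-∀
  shift : + (m + x) ℤ.- r ≡ (+ x ℤ.- r) ℤ.+ 1ℤ ℤ.* + m
  shift = identity (+ m) (+ x) r

χ-from-residue : ∀ r m .{{_ : NonZero m}} y → χ r m (r %ℕ m + y) ≡ 𝟙 (m ∣? y)
χ-from-residue r m y = 𝟙-cong (∣ᵤ-shift {v = + y} (ℤ.- (r /ℕ m)) shift) _ _
  where
  identity : ∀ a b q c → (a ℤ.+ b) ℤ.- (a ℤ.+ q ℤ.* c) ≡ b ℤ.+ (ℤ.- q) ℤ.* c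
  identity = solve-∀
  shift : + (r %ℕ m + y) ℤ.- r ≡ + y ℤ.+ (ℤ.- (r /ℕ m)) ℤ.* + m
  shift = trans (cong (ℤ._-_ (+ (r %ℕ m + y))) (a≡a%ℕn+[a/ℕn]*n r m))
                (identity (+ (r %ℕ m)) (+ y) (r /ℕ m) (+ m))

-- Translating the window by r %ℕ m turns the class r (mod m) into the multiples of m.
χ-window : ∀ r m .{{_ : NonZero m}} → sumBelow m (χ r m) ≡ 1
χ-window r m@(suc _) = begin
  sumBelow m (χ r m)                          ≡⟨ sumBelow-translate (χ-periodic r m) (r %ℕ m) ⟨
  sumBelow m (λ y → χ r m (r %ℕ m + y))       ≡⟨ sumBelow-cong m (χ-from-residue r m) ⟩
  sumBelow m (λ y → 𝟙 (m ∣? y))               ≡⟨ ∑-𝟙-unique (λ y → m ∣? toℕ y) (m ∣0) only-zero ⟩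
  1                                           ∎
  where
  open ≡-Reasoning
  only-zero : ∀ j → j ≢ zero → ¬ (m ∣ toℕ j)
  only-zero zero    0≢0 = contradiction refl 0≢0
  only-zero (suc j) _   = >⇒∤ (Fin.toℕ<n (suc j))

χ-count : ∀ r m .{{_ : NonZero m}} q → sumBelow (q * m) (χ r m) ≡ q
χ-count r m q =
  trans (sumBelow-periodic (χ-periodic r m) q) (trans (cong (q *_) (χ-window r m)) (*-identityʳ q))

modulus-nonZero : ∀ {k} (S : CongSystem k) i → NonZero (modulus S i)
modulus-nonZero S i = >-nonZero (≤-trans (s≤s z≤n) (modulus≥2 S i))

exact-covering-∑ : ∀ {k} (S : CongSystem k) → Covering S → Exact S →
                   ∀ N (c : Fin k → ℕ) → (∀ i → N ≡ c i * modulus S i) → ∑[ i < k ] c i ≡ N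
exact-covering-∑ {k} S cov exa N c N≡c*m = begin
  ∑[ i < k ] c i                               ≡⟨ sum-cong-≗ {x = λ i → sumBelow N (χᵢ i)} {y = c} count ⟨
  ∑[ i < k ] sumBelow N (χᵢ i)                 ≡⟨ ∑-comm {N} {k} (λ x i → χᵢ i (toℕ x)) ⟨
  sumBelow N (λ x → ∑[ i < k ] χᵢ i x)         ≡⟨ sumBelow-cong N one-class ⟩
  sumBelow N (λ _ → 1)                         ≡⟨ ∑-1 N ⟩
  N                                            ∎
  where
  open ≡-Reasoning
  χᵢ : Fin k → ℕ → ℕ
  χᵢ i = χ (residue S i) (modulus S i)
  count : ∀ i → sumBelow N (χᵢ i) ≡ c i
  count i rewrite N≡c*m i = χ-count (residue S i) (modulus S i) {{modulus-nonZero S i}} (c i)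
  one-class : ∀ x → ∑[ i < k ] χᵢ i x ≡ 1
  one-class x with cov (+ x)
  ... | i , x∈i = ∑-𝟙-unique (λ j → inClass? (residue S j) (modulus S j) (+ x)) x∈i
                    (λ j j≢i x∈j → exa j i j≢i (+ x) (x∈j , x∈i))

[1+d]^a≡1+d*s : ∀ d a → ∃ λ s → suc d ^ a ≡ 1 + d * s
[1+d]^a≡1+d*s d zero    = 0 , cong suc (sym (*-zeroʳ d))
[1+d]^a≡1+d*s d (suc a) with [1+d]^a≡1+d*s d a
... | s , [1+d]^a≡ = suc (suc d * s) , (begin
  suc d * suc d ^ a       ≡⟨ cong (suc d *_) [1+d]^a≡ ⟩
  suc d * (1 + d * s)     ≡⟨ expand d s ⟩
  1 + d * suc (suc d * s) ∎)
  where
  open ≡-Reasoning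
  expand : ∀ d s → suc d * (1 + d * s) ≡ 1 + d * suc (suc d * s)
  expand = NS.solve-∀

sum[1+d]^a≡k+d*t : ∀ d {k} (a : Fin k → ℕ) → ∃ λ t → ∑[ i < k ] (suc d ^ a i) ≡ k + d * t
sum[1+d]^a≡k+d*t d {k} a = sum s , (begin
  ∑[ i < k ] (suc d ^ a i)            ≡⟨ sum-cong-≗ {x = λ i → suc d ^ a i} (proj₂ ∘ [1+d]^a≡1+d*s d ∘ a) ⟩
  ∑[ i < k ] (1 + d * s i)            ≡⟨ ∑-distrib-+ (λ _ → 1) (λ i → d * s i) ⟩
  ∑[ i < k ] 1 + ∑[ i < k ] (d * s i) ≡⟨ cong₂ _+_ (∑-1 k) (sym (*-distribˡ-sum d s)) ⟩
  k + d * sum s                       ∎)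
  where
  open ≡-Reasoning
  s : Fin k → ℕ
  s = proj₁ ∘ [1+d]^a≡1+d*s d ∘ a

necessity : ∀ d k → ExactPowerCovering (suc d) k → d ∣ k ∸ 1
necessity d zero    _                      = d ∣0
necessity d (suc k) (S , cov , exa , pow) = ∣m+n∣m⇒∣n (subst (d ∣_) d*s≡d*t+k (m∣m*n s)) (m∣m*n t)
  where
  n = suc d
  e : Fin (suc k) → ℕ
  e = proj₁ ∘ pow
  E = ∑[ i < suc k ] e i
  n^E≡ : ∀ i → n ^ E ≡ n ^ (E ∸ e i) * modulus S i
  n^E≡ i = begin
    n ^ E                       ≡⟨ cong (n ^_) (m∸n+n≡m (term≤∑ e i)) ⟨
    n ^ (E ∸ e i + e i)         ≡⟨ ^-distribˡ-+-* n (E ∸ e i) (e i) ⟩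
    n ^ (E ∸ e i) * n ^ e i     ≡⟨ cong (n ^ (E ∸ e i) *_) (proj₂ (pow i)) ⟨
    n ^ (E ∸ e i) * modulus S i ∎
    where open ≡-Reasoning
  density : ∑[ i < suc k ] (n ^ (E ∸ e i)) ≡ n ^ E
  density = exact-covering-∑ S cov exa (n ^ E) (λ i → n ^ (E ∸ e i)) n^E≡
  s = proj₁ ([1+d]^a≡1+d*s d E)
  t = proj₁ (sum[1+d]^a≡k+d*t d (λ i → E ∸ e i))
  d*s≡d*t+k : d * s ≡ d * t + k
  d*s≡d*t+k = suc-injective (begin
    1 + d * s                      ≡⟨ proj₂ ([1+d]^a≡1+d*s d E) ⟨
    n ^ E                          ≡⟨ density ⟨
    ∑[ i < suc k ] (n ^ (E ∸ e i)) ≡⟨ proj₂ (sum[1+d]^a≡k+d*t d (λ i → E ∸ e i)) ⟩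
    suc k + d * t                  ≡⟨ cong suc (+-comm k (d * t)) ⟩
    suc (d * t + k)                ∎)
    where open ≡-Reasoning

InClass-%ℕ : ∀ x m .{{_ : NonZero m}} → InClass (+ (x %ℕ m)) m x
InClass-%ℕ x m = ∣⇒∣ᵤ {i = x ℤ.- + (x %ℕ m)} (dividesℤ (x /ℕ m) (begin
  x ℤ.- + (x %ℕ m)                                  ≡⟨ cong (ℤ._- + (x %ℕ m)) (a≡a%ℕn+[a/ℕn]*n x m) ⟩
  (+ (x %ℕ m) ℤ.+ (x /ℕ m) ℤ.* + m) ℤ.- + (x %ℕ m) ≡⟨ identity (+ (x %ℕ m)) ((x /ℕ m) ℤ.* + m) ⟩
  (x /ℕ m) ℤ.* + m                                  ∎))
  where
  open ≡-Reasoning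
  identity : ∀ a b → (a ℤ.+ b) ℤ.- a ≡ b
  identity = solve-∀

∃-residue : ∀ m .{{_ : NonZero m}} x → ∃ λ (ρ : Fin m) → InClass (+ toℕ ρ) m x
∃-residue m x = ρ , subst (λ a → InClass (+ a) m x) (sym (Fin.toℕ-fromℕ< ρ<m)) (InClass-%ℕ x m)
  where
  ρ<m = n%ℕd<d x m
  ρ = fromℕ< ρ<m

∣∧<⇒≡0 : ∀ {m j} → m ∣ j → j < m → j ≡ 0
∣∧<⇒≡0 {j = zero}  _   _   = refl
∣∧<⇒≡0 {j = suc _} m∣j j<m = contradiction m∣j (>⇒∤ j<m)

InClass-residue-unique : ∀ {m} x (a b : Fin m) → InClass (+ toℕ a) m x → InClass (+ toℕ b) m x → a ≡ b
InClass-residue-unique {m} x a b x∈a x∈b =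
  Fin.toℕ-injective (ℤ.+-injective (ℤ.i-j≡0⇒i≡j (+ toℕ a) (+ toℕ b)
    (trans (ℤ.m-n≡m⊖n (toℕ a) (toℕ b)) (ℤ.∣i∣≡0⇒i≡0 (∣∧<⇒≡0 m∣a⊖b a⊖b<m)))))
  where
  identity : ∀ x a b → (x ℤ.- b) ℤ.- (x ℤ.- a) ≡ a ℤ.- b
  identity = solve-∀
  m∣a-b : + m ℤᵤ.∣ (+ toℕ a ℤ.- + toℕ b)
  m∣a-b = ∣⇒∣ᵤ (subst (+ m ∣ℤ_) (identity x (+ toℕ a) (+ toℕ b))
            (ℤ.∣m∣n⇒∣m-n (∣ᵤ⇒∣ {i = x ℤ.- + toℕ b} x∈b) (∣ᵤ⇒∣ {i = x ℤ.- + toℕ a} x∈a)))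
  m∣a⊖b : m ∣ ℤ.∣ toℕ a ℤ.⊖ toℕ b ∣
  m∣a⊖b = subst (λ i → m ∣ ℤ.∣ i ∣) (ℤ.m-n≡m⊖n (toℕ a) (toℕ b)) m∣a-b
  a⊖b<m : ℤ.∣ toℕ a ℤ.⊖ toℕ b ∣ < m
  a⊖b<m = ≤-<-trans (ℤ.∣m⊝n∣≤m⊔n (toℕ a) (toℕ b)) (⊔-pres-<m (Fin.toℕ<n a) (Fin.toℕ<n b))

InClass-scale : ∀ n .{{_ : NonZero n}} r m q → InClass (r ℤ.* + n) (n * m) (q ℤ.* + n) ⇔ InClass r m q
InClass-scale n r m q = mk⇔
  (*-cancelˡ-∣ n ∘ subst (n * m ∣_) factor)
  (subst (n * m ∣_) (sym factor) ∘ *-monoʳ-∣ n)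
  where
  identity : ∀ q r n → q ℤ.* n ℤ.- r ℤ.* n ≡ n ℤ.* (q ℤ.- r)
  identity = solve-∀
  factor : ℤ.∣ q ℤ.* + n ℤ.- r ℤ.* + n ∣ ≡ n * ℤ.∣ q ℤ.- r ∣
  factor = trans (cong ℤ.∣_∣ (identity q r (+ n))) (ℤ.abs-* (+ n) (q ℤ.- r))

InClass-0⇔∣ : ∀ m x → InClass 0ℤ m x ⇔ + m ∣ℤ x
InClass-0⇔∣ m x = mk⇔
  (subst (+ m ∣ℤ_) (ℤ.+-identityʳ x) ∘ ∣ᵤ⇒∣ {i = x ℤ.- 0ℤ})
  (∣⇒∣ᵤ {i = x ℤ.- 0ℤ} ∘ subst (+ m ∣ℤ_) (sym (ℤ.+-identityʳ x)))

InClass-scaled⇒∣ : ∀ n r m x → InClass (r ℤ.* + n) (n * m) x → + n ∣ℤ x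
InClass-scaled⇒∣ n r m x x∈ = subst (+ n ∣ℤ_) (identity x (r ℤ.* + n))
  (ℤ.∣m∣n⇒∣m+n (∣ᵤ⇒∣ {i = x ℤ.- r ℤ.* + n} (∣-trans (m∣m*n m) x∈)) (ℤ.∣n⇒∣m*n r ℤ.∣-refl))
  where
  identity : ∀ x y → (x ℤ.- y) ℤ.+ y ≡ x
  identity = solve-∀

InClass-suc⇒∤ : ∀ {d} x (j : Fin d) → InClass (+ toℕ (Fin.suc j)) (suc d) x → ¬ (+ suc d ∣ℤ x)
InClass-suc⇒∤ {d} x j x∈j n∣x
  with InClass-residue-unique x (suc j) zero x∈j (Equivalence.from (InClass-0⇔∣ (suc d) x) n∣x)
... | ()

record ExactPowerFamily (n : ℕ) (I : Set) : Set where
  field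
    residue  : I → ℤ
    modulus  : I → ℕ
    powers   : ∀ i → IsPowerOf n (modulus i)
    covering : ∀ x → ∃ λ i → InClass (residue i) (modulus i) x
    exact    : ∀ i j → i ≢ j → ∀ x → ¬ (InClass (residue i) (modulus i) x × InClass (residue j) (modulus j) x)
open ExactPowerFamily

trivialFamily : ∀ {n} → ExactPowerFamily n (Fin 1)
trivialFamily .residue _             = 0ℤ
trivialFamily .modulus _             = 1
trivialFamily .powers _              = 0 , refl
trivialFamily .covering x            = zero , 1∣ _
trivialFamily .exact zero zero 0≢0 _ = contradiction refl 0≢0

reindex : ∀ {n I J} → J ↔ I → ExactPowerFamily n I → ExactPowerFamily n J
reindex e F .residue  = residue F ∘ Inverse.to e
reindex e F .modulus  = modulus F ∘ Inverse.to e
reindex e F .powers   = powers F ∘ Inverse.to e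
reindex e F .covering x with covering F x
... | i , x∈i = Inverse.from e i ,
  subst (λ i → InClass (residue F i) (modulus F i) x) (sym (Inverse.strictlyInverseˡ e i)) x∈i
reindex e F .exact j j′ j≢j′ = exact F (Inverse.to e j) (Inverse.to e j′) (j≢j′ ∘ Injection.injective (↔⇒↣ e))

module _ {d : ℕ} {I : Set} (F : ExactPowerFamily (suc d) I) where
  private
    n = suc d

  refine : ExactPowerFamily n (Fin d ⊎ I)
  refine .residue (inj₁ j) = + toℕ (Fin.suc j)
  refine .residue (inj₂ i) = residue F i ℤ.* + n
  refine .modulus (inj₁ j) = n
  refine .modulus (inj₂ i) = n * modulus F i
  refine .powers (inj₁ j) = 1 , sym (*-identityʳ n)
  refine .powers (inj₂ i) with powers F i
  ... | e , m≡n^e = suc e , cong (n *_) m≡n^e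
  refine .covering x with ∃-residue n x
  ... | suc j , x∈j = inj₁ j , x∈j
  ... | zero  , x∈0 with Equivalence.to (InClass-0⇔∣ n x) x∈0
  ...   | dividesℤ q refl with covering F q
  ...     | i , q∈i = inj₂ i , Equivalence.from (InClass-scale n (residue F i) (modulus F i) q) q∈i
  refine .exact (inj₁ a) (inj₁ b) a≢b x (x∈a , x∈b) =
    a≢b (cong inj₁ (Fin.suc-injective (InClass-residue-unique x (suc a) (suc b) x∈a x∈b)))
  refine .exact (inj₁ a) (inj₂ b) _ x (x∈a , x∈b) =
    InClass-suc⇒∤ x a x∈a (InClass-scaled⇒∣ n (residue F b) (modulus F b) x x∈b)
  refine .exact (inj₂ a) (inj₁ b) _ x (x∈a , x∈b) =
    InClass-suc⇒∤ x b x∈b (InClass-scaled⇒∣ n (residue F a) (modulus F a) x x∈a)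
  refine .exact (inj₂ a) (inj₂ b) a≢b x (x∈a , x∈b)
    with InClass-scaled⇒∣ n (residue F a) (modulus F a) x x∈a
  ... | dividesℤ q refl = exact F a b (a≢b ∘ cong inj₂) q
    (Equivalence.to (InClass-scale n _ _ q) x∈a , Equivalence.to (InClass-scale n _ _ q) x∈b)

  refine-modulus≥2 : 1 ≤ d → ∀ u → 2 ≤ modulus refine u
  refine-modulus≥2 1≤d (inj₁ _) = s≤s 1≤d
  refine-modulus≥2 1≤d (inj₂ i) with powers F i
  ... | e , m≡n^e = *-mono-≤ (s≤s 1≤d) (subst (1 ≤_) (sym m≡n^e) (m^n>0 n e))

splitting : ∀ d q → Fin (suc (suc q * d)) ↔ (Fin d ⊎ Fin (suc (q * d)))
splitting d q = subst (λ m → Fin m ↔ (Fin d ⊎ Fin (suc (q * d)))) (+-suc d (q * d)) (+↔⊎ {d})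

iteratedRefinement : ∀ d q → ExactPowerFamily (suc d) (Fin (suc (q * d)))
iteratedRefinement d zero    = trivialFamily
iteratedRefinement d (suc q) = reindex (splitting d q) (refine (iteratedRefinement d q))

family⇒covering : ∀ {n k} (F : ExactPowerFamily n (Fin k)) → (∀ i → 2 ≤ modulus F i) →
                  ExactPowerCovering n k
family⇒covering F ≥2 =
  record { residue = residue F ; modulus = modulus F ; modulus≥2 = ≥2 } , covering F , exact F , powers F

sufficiency : ∀ d k → 1 ≤ d → 1 < k → d ∣ k ∸ 1 → ExactPowerCovering (suc d) k
sufficiency d (suc k) 1≤d (s≤s ()) (divides zero refl)
sufficiency d (suc k) 1≤d _        (divides (suc q) refl) =
  family⇒covering (iteratedRefinement d (suc q))
    (refine-modulus≥2 (iteratedRefinement d q) 1≤d ∘ Inverse.to (splitting d q))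

proposition2p12 : ∀ (k n : ℕ) → 1 < k → 1 < n →
    (∃ λ (S : CongSystem k) → Covering S × Exact S × AllModuliPowersOf n S)
    ⇔ ((n ∸ 1) ∣ (k ∸ 1))
proposition2p12 k (suc d) 1<k (s≤s 1≤d) = mk⇔ (necessity d k) (sufficiency d k 1≤d 1<k)
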